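{- Let $n\ge 1$, $k\ge1$ and let $(e_1,\dots,e_k)$ be non-negative integers with $\sum_i e_i\ge\binom n2$. Every standard colouring of $K_n$ with respect to $(e_1,\dots,e_k)$ contains no rainbow cycle, and therefore is rainbow $H$-free for every graph $H$ of degeneracy $2$.
   Context: Standard colouring: run the following procedure. Start with the multiset $S_0=\{K_n\}$ (a partition of $V(K_n)$ into one part) and budgets $e_{0,j}=e_j$ for $j\in[k]$. At step $\ell\ge 0$: if every member of $S_\ell$ is a $K_1$, stop. Otherwise choose a member $K_m\in S_\ell$ with $m\ge 2$, a colour $i\in[k]$ and an integer $1\le t\le\lfloor m/2\rfloor$ with $t(m-t)\le e_{\ell,i}$; split the vertex set of $K_m$ into parts of sizes $t$ and $m-t$, colour all $t(m-t)$ edges between them with colour $i$, and set $S_{\ell+1}=(S_\ell\setminus\{K_m\})\cup\{K_t,K_{m-t}\}$, $e_{\ell+1,i}=e_{\ell,i}-t(m-t)$, $e_{\ell+1,j}=e_{\ell,j}$ for $j\ne i$ (a "standard colouring step of size $t$"). An edge colouring of $K_n$ obtainable as the final result of this procedure is a standard colouring. A cycle is rainbow if its edges have pairwise distinct colours; a colouring is rainbow $H$-free if no subgraph isomorphic to $H$ has all edges of distinct colours. A graph is $d$-degenerate if every subgraph has a vertex of degree at most $d$; the degeneracy is the least positive such $d$. -}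

module Defs where

open import Data.Nat using (ℕ; zero; suc; _+_; _*_; _∸_; _≤_; _<_)
open import Data.Nat.DivMod using (_/_)
open import Data.Fin using (Fin; _≟_)
open import Data.Fin.Subset using (Subset; _∈_; _∉_; ∣_∣; Nonempty)
open import Data.List using (List; []; _∷_; _++_; length; zipWith; [_]; allFin)
open import Data.List.Relation.Unary.All using (All)
open import Data.List.Relation.Unary.Unique.Propositional using (Unique)
open import Data.List.Relation.Binary.Permutation.Propositional using (_↭_)
open import Data.List.Membership.Propositional using () renaming (_∈_ to _∈ₗ_)
open import Data.Product using (Σ; ∃; ∃-syntax; _×_; _,_)
open import Data.Sum using (_⊎_)
open import Relation.Nullary using (¬_; yes; no)
open import Relation.Binary.PropositionalEquality using (_≡_)
open import Relation.Binary.Construct.Closure.ReflexiveTransitive using (Star)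
open import Function.Definitions using (Injective)

-- Vertices of K_n are Fin n; the edge {x,y} (x ≢ y) gets colour c x y.
-- (Values on the diagonal are irrelevant; standard colourings are
-- forced to be symmetric off the diagonal, see Step below.)

Colouring : ℕ → ℕ → Set
Colouring n k = Fin n → Fin n → Fin k

Budget : ℕ → Set
Budget k = Fin k → ℕ

spend : ∀ {k} → Budget k → Fin k → ℕ → Budget k
spend e i w j with j ≟ i
... | yes _ = e j ∸ w
... | no  _ = e j

-- State of the procedure: the multiset S_ℓ of cliques (each given by its
-- list of vertices, a part of the partition of V(K_n)) and current budgets.
record State (n k : ℕ) : Set where
  constructor ⟨_,_⟩
  field
    parts   : List (List (Fin n))
    budgets : Budget k

-- One standard colouring step, as recorded in the final colouring c:
-- choose a part P (= K_m, m = length P ≥ 2) of S, a colour i, and split P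
-- into A (size t) and B (size m - t), 1 ≤ t ≤ ⌊m/2⌋, t(m-t) ≤ e_{ℓ,i};
-- all edges between A and B receive colour i.
data Step {n k : ℕ} (c : Colouring n k) : State n k → State n k → Set where
  step : (xs ys : List (List (Fin n))) (P A B : List (Fin n))
         (e : Budget k) (i : Fin k) →
         2 ≤ length P →
         P ↭ A ++ B →
         1 ≤ length A →
         length A ≤ length P / 2 →
         length A * (length P ∸ length A) ≤ e i →
         (∀ x y → x ∈ₗ A → y ∈ₗ B → c x y ≡ i × c y x ≡ i) →
         Step c ⟨ xs ++ P ∷ ys , e ⟩
                ⟨ xs ++ A ∷ B ∷ ys , spend e i (length A * (length P ∸ length A)) ⟩

Standard : ∀ {n k} → Budget k → Colouring n k → Set
Standard {n} {k} e c =
  ∃[ final ] (Star (Step c) ⟨ allFin n ∷ [] , e ⟩ final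
              × All (λ P → length P ≡ 1) (State.parts final))

-- Cycles in K_n: a list v₀ … v_{L-1} of L ≥ 3 distinct vertices, with edges
-- v_j v_{j+1} (indices mod L).  Its edge colours, in order:

cycleColours : ∀ {n k} → Colouring n k → Fin n → List (Fin n) → List (Fin k)
cycleColours c v rest = zipWith c (v ∷ rest) (rest ++ [ v ])

RainbowCycle : ∀ {n k} → Colouring n k → Set
RainbowCycle {n} c =
  Σ (Fin n) λ v → Σ (List (Fin n)) λ rest →
    Unique (v ∷ rest) × 3 ≤ length (v ∷ rest) × Unique (cycleColours c v rest)

record Graph (p : ℕ) : Set where
  field
    adj    : Fin p → Subset p
    sym    : ∀ u v → u ∈ adj v → v ∈ adj u
    irrefl : ∀ v → v ∉ adj v

IsSubgraph : ∀ {p} → Graph p → Subset p → (Fin p → Subset p) → Set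
IsSubgraph {p} H S F =
  (∀ u v → u ∈ F v → u ∈ Graph.adj H v × u ∈ S × v ∈ S) ×
  (∀ u v → u ∈ F v → v ∈ F u)

Degenerate : ∀ {p} → ℕ → Graph p → Set
Degenerate {p} d H =
  ∀ (S : Subset p) (F : Fin p → Subset p) → IsSubgraph H S F → Nonempty S →
  ∃[ v ] (v ∈ S × ∣ F v ∣ ≤ d)

-- degeneracy of H = least positive d such that H is d-degenerate.
-- Degeneracy equal to 2: 2-degenerate but not 1-degenerate.
DegeneracyTwo : ∀ {p} → Graph p → Set
DegeneracyTwo H = Degenerate 2 H × ¬ Degenerate 1 H

RainbowCopy : ∀ {n k p} → Colouring n k → (H : Graph p) → (Fin p → Fin n) → Set
RainbowCopy {n} {k} {p} c H f =
  ∀ u v u' v' → u ∈ Graph.adj H v → u' ∈ Graph.adj H v' →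
  c (f u) (f v) ≡ c (f u') (f v') →
  (u ≡ u' × v ≡ v') ⊎ (u ≡ v' × v ≡ u')

RainbowFree : ∀ {n k p} → Colouring n k → Graph p → Set
RainbowFree {n} {k} {p} c H =
  ¬ (Σ (Fin p → Fin n) λ f → Injective _≡_ _≡_ f × RainbowCopy c H f)

-- Both claims come from one invariant of the splitting procedure: a property of
-- parts that passes to one of the two halves whenever a part is split along a
-- monochromatic cut, and that no single vertex has, cannot hold for V(K_n).
-- A cycle meeting both halves of a cut crosses it at least twice, so the vertex
-- set of a rainbow cycle stays inside one part, which is absurd once all parts
-- are singletons.  If H is not 1-degenerate, some subgraph of H has minimum
-- degree 2; in a rainbow copy at most one edge of it crosses any cut, and a
-- vertex set spanning minimum degree 1, with degree 2 at all vertices but one,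
-- keeps that property on one side after such a cut.

module Submission where

open import Defs
open import Data.Nat using (ℕ; _≤_; s≤s)
open import Data.Nat.Combinatorics using (_C_)
open import Data.Nat.ListAction using (sum)
open import Data.Nat.Properties using (<⇒≤; ≰⇒>; _≤?_)
open import Data.Bool using (true; false)
open import Data.Fin using (Fin; zero; suc; _≟_)
open import Data.Fin.Properties using (any?; suc-injective)
open import Data.Fin.Subset using (Subset; ∣_∣; Nonempty) renaming (_∈_ to _∈ₛ_)
open import Data.Fin.Subset.Properties using () renaming (_∈?_ to _∈ₛ?_)
import Data.Vec.Base as Vec
open import Data.List using (List; []; _∷_; _++_; [_]; length; zipWith; allFin; tabulate)
open import Data.List.Properties using (++-assoc)
open import Data.List.Relation.Unary.All as All using (All; []; _∷_; lookupAny)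
open import Data.List.Relation.Unary.All.Properties using (++⁻ˡ; ++⁻ʳ)
open import Data.List.Relation.Unary.Any using (Any; here; there)
open import Data.List.Relation.Unary.Any.Properties using (++⁻; ++⁺ˡ; ++⁺ʳ)
open import Data.List.Relation.Unary.Unique.Propositional using (Unique)
open import Data.List.Relation.Unary.AllPairs using (_∷_)
open import Data.List.Relation.Binary.Permutation.Propositional using (_↭_)
open import Data.List.Relation.Binary.Permutation.Propositional.Properties using (∈-resp-↭)
open import Data.List.Membership.Propositional using (_∈_; _∉_; find)
open import Data.List.Membership.Propositional.Properties using (∈-++⁻; ∈-allFin; ∈-∃++)
open import Data.Product using (_×_; _,_; proj₁; proj₂; ∃; ∃₂; ∃-syntax; swap)
open import Data.Sum as Sum using (_⊎_; inj₁; inj₂)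
open import Data.Empty using (⊥-elim)
open import Function using (_∘_)
open import Function.Definitions using (Injective)
open import Level using (Level; 0ℓ)
open import Relation.Nullary using (¬_; yes; no; _×-dec_)
open import Relation.Unary using (Pred; Decidable; Satisfiable; _⊆_; _∪_; _∩_; ∁; _⊥_)
open import Relation.Unary.Properties using (_∩?_; ∁?)
open import Relation.Binary.PropositionalEquality using (_≡_; _≢_; refl; sym; trans; cong; subst; module ≡-Reasoning)
open import Relation.Binary.Construct.Closure.ReflexiveTransitive using (Star; ε; _◅_)

private
  variable
    ℓ ℓ₁ ℓ₂ : Level
    n k p : ℕ
    A : Set ℓ

CutColoured : Colouring n k → Fin k → Pred (Fin n) ℓ₁ → Pred (Fin n) ℓ₂ → Set _
CutColoured c i X Y = ∀ x y → X x → Y y → c x y ≡ i × c y x ≡ i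

cut-sym : ∀ {c : Colouring n k} {i} {X : Pred (Fin n) ℓ₁} {Y : Pred (Fin n) ℓ₂} →
          CutColoured c i X Y → CutColoured c i Y X
cut-sym cut y x Yy Xx = swap (cut x y Xx Yy)

SplitStable : Colouring n k → Pred (List (Fin n)) ℓ → Set ℓ
SplitStable c Q = ∀ {P A B i} → P ↭ A ++ B → CutColoured c i (_∈ A) (_∈ B) → Q P → Q A ⊎ Q B

module _ {c : Colouring n k} {Q : Pred (List (Fin n)) ℓ} (stable : SplitStable c Q) where

  any-step : ∀ {s s'} → Step c s s' → Any Q (State.parts s) → Any Q (State.parts s')
  any-step (step xs ys P A B e i _ P↭A++B _ _ _ cut) q with ++⁻ xs q
  ... | inj₁ q-xs        = ++⁺ˡ q-xs
  ... | inj₂ (there q-ys) = ++⁺ʳ xs (there (there q-ys))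
  ... | inj₂ (here qP)    = ++⁺ʳ xs (Sum.[ here , there ∘ here ]′ (stable P↭A++B cut qP))

  any-steps : ∀ {s s'} → Star (Step c) s s' → Any Q (State.parts s) → Any Q (State.parts s')
  any-steps ε        q = q
  any-steps (s ◅ ss) q = any-steps ss (any-step s q)

  standard-invariant : ∀ {e : Budget k} → Standard e c → (∀ x → ¬ Q [ x ]) → ¬ Q (allFin n)
  standard-invariant (_ , steps , singletons) ¬Q[x] q =
    ¬Q-length≡1 (lookupAny singletons (any-steps steps (here q)))
    where
    ¬Q-length≡1 : ∀ {P} → ¬ (length P ≡ 1 × Q P)
    ¬Q-length≡1 {x ∷ []} (_ , qP) = ¬Q[x] x qP

walkColours : Colouring n k → Fin n → List (Fin n) → List (Fin k)
walkColours c a []      = []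
walkColours c a (b ∷ l) = c a b ∷ walkColours c b l

module _ (c : Colouring n k) where

  zipWith≡walkColours : ∀ a l w → zipWith c (a ∷ l) (l ++ [ w ]) ≡ walkColours c a (l ++ [ w ])
  zipWith≡walkColours a []      w = refl
  zipWith≡walkColours a (b ∷ l) w = cong (c a b ∷_) (zipWith≡walkColours b l w)

  walkColours-++ : ∀ a l b m → walkColours c a (l ++ b ∷ m) ≡ walkColours c a (l ++ [ b ]) ++ walkColours c b m
  walkColours-++ a []      b m = refl
  walkColours-++ a (x ∷ l) b m = cong (c a x ∷_) (walkColours-++ x l b m)

  walk-across-cut : ∀ {i} {X : Pred (Fin n) ℓ₁} {Y : Pred (Fin n) ℓ₂} {a b l} →
                    CutColoured c i X Y → All (X ∪ Y) l → X a → Y b → i ∈ walkColours c a (l ++ [ b ])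
  walk-across-cut cut []              Xa Yb = here (sym (proj₁ (cut _ _ Xa Yb)))
  walk-across-cut cut (inj₁ Xx ∷ l)  Xa Yb = there (walk-across-cut cut l Xx Yb)
  walk-across-cut cut (inj₂ Yx ∷ _)  Xa _  = here (sym (proj₁ (cut _ _ Xa Yx)))

All∪⇒All⊎Any : ∀ {X : Pred A ℓ₁} {Y : Pred A ℓ₂} {xs} → All (X ∪ Y) xs → All X xs ⊎ Any Y xs
All∪⇒All⊎Any []             = inj₁ []
All∪⇒All⊎Any (inj₂ y ∷ _)   = inj₂ (here y)
All∪⇒All⊎Any (inj₁ x ∷ xys) = Sum.map (x ∷_) there (All∪⇒All⊎Any xys)

Unique-++⇒disjoint : ∀ {xs ys} {x : A} → Unique (xs ++ ys) → x ∈ xs → x ∉ ys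
Unique-++⇒disjoint {xs = _ ∷ xs} (z∉ ∷ _) (here refl) x∈ys = All.lookup (++⁻ʳ xs z∉) x∈ys refl
Unique-++⇒disjoint (_ ∷ unique) (there x∈xs) = Unique-++⇒disjoint unique x∈xs

Unique⇒¬All∈[_] : ∀ (x : A) {xs} → Unique xs → 2 ≤ length xs → ¬ All (_∈ [ x ]) xs
Unique⇒¬All∈[ x ] {_ ∷ []}    _               (s≤s ()) _
Unique⇒¬All∈[ x ] {_ ∷ _ ∷ _} ((y≢z ∷ _) ∷ _) _ (here refl ∷ here refl ∷ _) = y≢z refl

-- The cycle passes from X to Y at some step and back from Y to X at a later one;
-- both steps cross the cut, so colour i occurs twice.
cycle-across-cut-not-rainbow : ∀ {c : Colouring n k} {i} {X : Pred (Fin n) ℓ₁} {Y : Pred (Fin n) ℓ₂} {v rest} →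
  CutColoured c i X Y → All (X ∪ Y) rest → X v → Any Y rest → ¬ Unique (cycleColours c v rest)
cycle-across-cut-not-rainbow {c = c} {v = v} cut sides Xv Yrest rainbow
  with u , u∈rest , Yu ← find Yrest
  with pre , suf , refl ← ∈-∃++ u∈rest =
  Unique-++⇒disjoint (subst Unique colours rainbow)
    (walk-across-cut c cut (++⁻ˡ pre sides) Xv Yu)
    (walk-across-cut c (cut-sym cut) (All.map Sum.swap (All.tail (++⁻ʳ pre sides))) Yu Xv)
  where
  open ≡-Reasoning
  colours : cycleColours c v (pre ++ u ∷ suf) ≡ walkColours c v (pre ++ [ u ]) ++ walkColours c u (suf ++ [ v ])
  colours = begin
    cycleColours c v (pre ++ u ∷ suf)          ≡⟨ zipWith≡walkColours c v (pre ++ u ∷ suf) v ⟩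
    walkColours c v ((pre ++ u ∷ suf) ++ [ v ]) ≡⟨ cong (walkColours c v) (++-assoc pre (u ∷ suf) [ v ]) ⟩
    walkColours c v (pre ++ u ∷ suf ++ [ v ])   ≡⟨ walkColours-++ c v pre u (suf ++ [ v ]) ⟩
    walkColours c v (pre ++ [ u ]) ++ walkColours c u (suf ++ [ v ]) ∎

rainbow-cycle-on-one-side : ∀ {c : Colouring n k} {i} {X : Pred (Fin n) ℓ₁} {Y : Pred (Fin n) ℓ₂} {v rest} →
  CutColoured c i X Y → Unique (cycleColours c v rest) →
  All (X ∪ Y) (v ∷ rest) → All X (v ∷ rest) ⊎ All Y (v ∷ rest)
rainbow-cycle-on-one-side cut rainbow (inj₁ Xv ∷ sides) =
  Sum.map (Xv ∷_) (λ Yrest → ⊥-elim (cycle-across-cut-not-rainbow cut sides Xv Yrest rainbow))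
    (All∪⇒All⊎Any sides)
rainbow-cycle-on-one-side cut rainbow (inj₂ Yv ∷ sides) =
  Sum.swap (Sum.map (Yv ∷_) (λ Xrest → ⊥-elim (cycle-across-cut-not-rainbow (cut-sym cut) sides′ Yv Xrest rainbow))
    (All∪⇒All⊎Any sides′))
  where sides′ = All.map Sum.swap sides

no-rainbow-cycle : ∀ {e : Budget k} {c : Colouring n k} → Standard e c → ¬ RainbowCycle c
no-rainbow-cycle {n = n} {c = c} std (v , rest , distinct , 3≤length , rainbow) =
  standard-invariant stable std (λ x → Unique⇒¬All∈[ x ] distinct (<⇒≤ 3≤length))
    (All.tabulate (λ {x} _ → ∈-allFin x))
  where
  stable : SplitStable c (λ P → All (_∈ P) (v ∷ rest))
  stable {A = A} P↭A++B cut vs∈P =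
    rainbow-cycle-on-one-side cut rainbow (All.map (∈-++⁻ A ∘ ∈-resp-↭ P↭A++B) vs∈P)

module Cores {p} (F : Fin p → Subset p) where

  NeighbourIn : Pred (Fin p) 0ℓ → Fin p → Set
  NeighbourIn W v = ∃[ u ] u ∈ₛ F v × W u

  TwoNeighboursIn : Pred (Fin p) 0ℓ → Fin p → Set
  TwoNeighboursIn W v = ∃₂ λ u u' → u ≢ u' × (u ∈ₛ F v × W u) × (u' ∈ₛ F v × W u')

  record AlmostTwoCore (W : Pred (Fin p) 0ℓ) : Set where
    field
      root       : Fin p
      neighbour  : W ⊆ NeighbourIn W
      neighbours : ∀ {v} → W v → v ≢ root → TwoNeighboursIn W v

  NonemptyCore : Pred (Fin p) 0ℓ → Set
  NonemptyCore W = AlmostTwoCore W × Satisfiable W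

  AtMostOneEdge : Pred (Fin p) 0ℓ → Pred (Fin p) 0ℓ → Set
  AtMostOneEdge W₁ W₂ = ∀ {v u v' u'} → W₁ v → W₂ u → u ∈ₛ F v → W₁ v' → W₂ u' → u' ∈ₛ F v' → v ≡ v' × u ≡ u'

  Symmetric : Set
  Symmetric = ∀ {u v} → u ∈ₛ F v → v ∈ₛ F u

  AtMostOneEdge-sym : ∀ {W₁ W₂} → Symmetric → AtMostOneEdge W₁ W₂ → AtMostOneEdge W₂ W₁
  AtMostOneEdge-sym sym-F one W₂v W₁u u∈Fv W₂v' W₁u' u'∈Fv' =
    swap (one W₁u W₂v (sym-F u∈Fv) W₁u' W₂v' (sym-F u'∈Fv'))

  core-resp : ∀ {W W'} → W ⊆ W' → W' ⊆ W → AlmostTwoCore W → AlmostTwoCore W'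
  core-resp W⊆W' W'⊆W core = record
    { root       = root
    ; neighbour  = λ W'v → let u , u∈Fv , Wu = neighbour (W'⊆W W'v) in u , u∈Fv , W⊆W' Wu
    ; neighbours = λ W'v v≢root →
        let u , u' , u≢u' , (u∈Fv , Wu) , (u'∈Fv , Wu') = neighbours (W'⊆W W'v) v≢root
        in u , u' , u≢u' , (u∈Fv , W⊆W' Wu) , (u'∈Fv , W⊆W' Wu')
    }
    where open AlmostTwoCore core

  module Restrict {W W₁ W₂ : Pred (Fin p) 0ℓ} (W₁? : Decidable W₁) (W₂? : Decidable W₂)
                  (cover : W ⊆ W₁ ∪ W₂) (W₁⊆W : W₁ ⊆ W) (one : AtMostOneEdge W₁ W₂) where

    CrossingAt : Fin p → Set
    CrossingAt v = ∃[ u ] u ∈ₛ F v × W₂ u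

    keep-one : ∀ {v} → W₁ v → TwoNeighboursIn W v → NeighbourIn W₁ v
    keep-one W₁v (u , u' , u≢u' , (u∈Fv , Wu) , (u'∈Fv , Wu')) with cover Wu | cover Wu'
    ... | inj₁ W₁u | _        = u , u∈Fv , W₁u
    ... | inj₂ _   | inj₁ W₁u' = u' , u'∈Fv , W₁u'
    ... | inj₂ W₂u | inj₂ W₂u' = ⊥-elim (u≢u' (proj₂ (one W₁v W₂u u∈Fv W₁v W₂u' u'∈Fv)))

    keep-two : ∀ {v} → ¬ CrossingAt v → TwoNeighboursIn W v → TwoNeighboursIn W₁ v
    keep-two no-cross (u , u' , u≢u' , (u∈Fv , Wu) , (u'∈Fv , Wu')) with cover Wu | cover Wu'
    ... | inj₁ W₁u | inj₁ W₁u' = u , u' , u≢u' , (u∈Fv , W₁u) , (u'∈Fv , W₁u')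
    ... | inj₂ W₂u | _         = ⊥-elim (no-cross (u , u∈Fv , W₂u))
    ... | _        | inj₂ W₂u' = ⊥-elim (no-cross (u' , u'∈Fv , W₂u'))

    -- The endpoint in W₁ of the only crossing edge, if there is one.
    crossing-endpoint : Fin p → ∃[ r ] (∀ {v} → W₁ v → v ≢ r → ¬ CrossingAt v)
    crossing-endpoint default with any? (λ v → W₁? v ×-dec any? (λ u → (u ∈ₛ? F v) ×-dec W₂? u))
    ... | yes (r , W₁r , u₀ , u₀∈Fr , W₂u₀) =
      r , λ W₁v v≢r (u , u∈Fv , W₂u) → v≢r (proj₁ (one W₁v W₂u u∈Fv W₁r W₂u₀ u₀∈Fr))
    ... | no none = default , λ {v} W₁v _ crossing → none (v , W₁v , crossing)

    core-restrict : (core : AlmostTwoCore W) → ¬ W₁ (AlmostTwoCore.root core) → AlmostTwoCore W₁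
    core-restrict core root∉W₁ = record
      { root       = r
      ; neighbour  = λ W₁v → keep-one W₁v (two W₁v)
      ; neighbours = λ W₁v v≢r → keep-two (no-cross W₁v v≢r) (two W₁v)
      }
      where
      open AlmostTwoCore core
      two : ∀ {v} → W₁ v → TwoNeighboursIn W v
      two W₁v = neighbours (W₁⊆W W₁v) (λ { refl → root∉W₁ W₁v })
      r = proj₁ (crossing-endpoint root)
      no-cross = proj₂ (crossing-endpoint root)

  -- Keep the side not containing the root if it is nonempty; otherwise the
  -- other side is all of W.
  core-split-away : ∀ {W W₁ W₂} → Decidable W₁ → Decidable W₂ → W ⊆ W₁ ∪ W₂ → W₁ ⊆ W → W₂ ⊆ W →
    AtMostOneEdge W₁ W₂ → (core : AlmostTwoCore W) → ¬ W₁ (AlmostTwoCore.root core) →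
    Satisfiable W → NonemptyCore W₁ ⊎ NonemptyCore W₂
  core-split-away W₁? W₂? cover W₁⊆W W₂⊆W one core root∉W₁ (w , Ww) with any? W₁?
  ... | yes W₁≠∅ = inj₁ (Restrict.core-restrict W₁? W₂? cover W₁⊆W one core root∉W₁ , W₁≠∅)
  ... | no  W₁=∅ = inj₂ (core-resp W⊆W₂ W₂⊆W core , w , W⊆W₂ Ww)
    where
    W⊆W₂ : _ ⊆ _
    W⊆W₂ {v} Wv = Sum.[ (λ W₁v → ⊥-elim (W₁=∅ (v , W₁v))) , (λ W₂v → W₂v) ]′ (cover Wv)

  core-split : ∀ {W W₁ W₂} → Symmetric → Decidable W₁ → Decidable W₂ → W ⊆ W₁ ∪ W₂ →
    W₁ ⊆ W → W₂ ⊆ W → W₁ ⊥ W₂ → AtMostOneEdge W₁ W₂ →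
    NonemptyCore W → NonemptyCore W₁ ⊎ NonemptyCore W₂
  core-split sym-F W₁? W₂? cover W₁⊆W W₂⊆W disjoint one (core , W≠∅) with W₁? (AlmostTwoCore.root core)
  ... | no  root∉W₁ = core-split-away W₁? W₂? cover W₁⊆W W₂⊆W one core root∉W₁ W≠∅
  ... | yes root∈W₁ = Sum.swap (core-split-away W₂? W₁? (Sum.swap ∘ cover) W₂⊆W W₁⊆W
                        (AtMostOneEdge-sym sym-F one) core (λ root∈W₂ → disjoint (root∈W₁ , root∈W₂)) W≠∅)

member : (s : Subset p) → 1 ≤ ∣ s ∣ → ∃ (_∈ₛ s)
member (true  Vec.∷ s) _ = zero , Vec.here
member (false Vec.∷ s) 1≤∣s∣ = let u , u∈s = member s 1≤∣s∣ in suc u , Vec.there u∈s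

two-members : (s : Subset p) → 2 ≤ ∣ s ∣ → ∃₂ λ u u' → u ≢ u' × u ∈ₛ s × u' ∈ₛ s
two-members (true  Vec.∷ s) (s≤s 1≤∣s∣) =
  let u , u∈s = member s 1≤∣s∣ in zero , suc u , (λ ()) , Vec.here , Vec.there u∈s
two-members (false Vec.∷ s) 2≤∣s∣ =
  let u , u' , u≢u' , u∈s , u'∈s = two-members s 2≤∣s∣
  in suc u , suc u' , u≢u' ∘ suc-injective , Vec.there u∈s , Vec.there u'∈s

module _ {H : Graph p} {S F} (sub : IsSubgraph H S F) where
  open Cores F

  min-degree-two-core : (∀ {v} → v ∈ₛ S → 2 ≤ ∣ F v ∣) → Nonempty S → NonemptyCore (_∈ₛ S)
  min-degree-two-core 2≤deg (w , w∈S) =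
    record { root = w ; neighbour = neighbour ; neighbours = λ v∈S _ → two v∈S } , w , w∈S
    where
    ∈S : ∀ {u v} → u ∈ₛ F v → u ∈ₛ S
    ∈S {u} {v} u∈Fv = proj₁ (proj₂ (proj₁ sub u v u∈Fv))
    two : ∀ {v} → v ∈ₛ S → TwoNeighboursIn (_∈ₛ S) v
    two {v} v∈S = let u , u' , u≢u' , u∈Fv , u'∈Fv = two-members (F v) (2≤deg v∈S)
                  in u , u' , u≢u' , (u∈Fv , ∈S u∈Fv) , (u'∈Fv , ∈S u'∈Fv)
    neighbour : ∀ {v} → v ∈ₛ S → NeighbourIn (_∈ₛ S) v
    neighbour v∈S = let u , _ , _ , Nu , _ = two v∈S in u , Nu

module _ {e : Budget k} {c : Colouring n k} (std : Standard e c) {H : Graph p} {f : Fin p → Fin n}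
         (f-inj : Injective _≡_ _≡_ f) (rainbow : RainbowCopy c H f) where

  no-core-in-rainbow-copy : ∀ {F} → (∀ {u v} → u ∈ₛ F v → u ∈ₛ Graph.adj H v) → Cores.Symmetric F →
                            ∀ {W} → Decidable W → ¬ Cores.NonemptyCore F W
  no-core-in-rainbow-copy {F} F⊆H sym-F W? core =
    standard-invariant stable std singleton (_ , W? , (λ {v} _ → ∈-allFin (f v)) , core)
    where
    open Cores F
    open import Data.List.Membership.DecPropositional (_≟_ {n}) using (_∈?_)
    Q : Pred (List (Fin n)) _
    Q P = ∃ λ W → Decidable W × (∀ {v} → W v → f v ∈ P) × NonemptyCore W

    singleton : ∀ x → ¬ Q [ x ]
    singleton x (W , _ , f[W]⊆[x] , core , w , Ww)
      with u , u∈Fw , Wu ← AlmostTwoCore.neighbour core Ww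
      with here fu≡x ← f[W]⊆[x] Wu | here fw≡x ← f[W]⊆[x] Ww
      with refl ← f-inj (trans fu≡x (sym fw≡x)) = Graph.irrefl H u (F⊆H u∈Fw)

    stable : SplitStable c Q
    stable {P} {A} {B} {i} P↭A++B cut (W , W? , f[W]⊆P , core) =
      Sum.map (λ core₁ → W₁ , W₁? , proj₂ , core₁) (λ core₂ → W₂ , W₂? , f[W₂]⊆B , core₂)
        (core-split sym-F W₁? W₂? cover proj₁ proj₁ (λ ((_ , fv∈A) , (_ , fv∉A)) → fv∉A fv∈A) one core)
      where
      W₁ W₂ : Pred (Fin p) 0ℓ
      W₁ = W ∩ (λ v → f v ∈ A)
      W₂ = W ∩ ∁ (λ v → f v ∈ A)
      W₁? : Decidable W₁
      W₁? = W? ∩? (λ v → f v ∈? A)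
      W₂? : Decidable W₂
      W₂? = W? ∩? ∁? (λ v → f v ∈? A)
      cover : W ⊆ W₁ ∪ W₂
      cover {v} Wv with f v ∈? A
      ... | yes fv∈A = inj₁ (Wv , fv∈A)
      ... | no  fv∉A = inj₂ (Wv , fv∉A)
      f[W₂]⊆B : ∀ {v} → W₂ v → f v ∈ B
      f[W₂]⊆B (Wv , fv∉A) =
        Sum.[ (λ fv∈A → ⊥-elim (fv∉A fv∈A)) , (λ fv∈B → fv∈B) ]′ (∈-++⁻ A (∈-resp-↭ P↭A++B (f[W]⊆P Wv)))
      -- A second edge between the sides would get the same colour i.
      one : AtMostOneEdge W₁ W₂
      one (Wv , fv∈A) W₂u u∈Fv (Wv' , fv'∈A) W₂u' u'∈Fv'
        with rainbow _ _ _ _ (F⊆H u∈Fv) (F⊆H u'∈Fv')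
               (trans (proj₂ (cut _ _ fv∈A (f[W₂]⊆B W₂u))) (sym (proj₂ (cut _ _ fv'∈A (f[W₂]⊆B W₂u')))))
      ... | inj₁ (u≡u' , v≡v') = v≡v' , u≡u'
      ... | inj₂ (refl , _)    = ⊥-elim (proj₂ W₂u fv'∈A)

rainbow-free : ∀ {e : Budget k} {c : Colouring n k} → Standard e c →
               (H : Graph p) → ¬ Degenerate 1 H → RainbowFree c H
rainbow-free std H not-1-degenerate (f , f-inj , rainbow) = not-1-degenerate 1-degenerate
  where
  1-degenerate : Degenerate 1 H
  1-degenerate S F sub S≠∅ with any? (λ v → (v ∈ₛ? S) ×-dec (∣ F v ∣ ≤? 1))
  ... | yes low-degree = low-degree
  ... | no  none       = ⊥-elim (no-core-in-rainbow-copy std {H = H} f-inj rainbow F⊆H (λ {u} {v} → proj₂ sub u v)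
                           (_∈ₛ? S) (min-degree-two-core {H = H} sub 2≤deg S≠∅))
    where
    F⊆H : ∀ {u v} → u ∈ₛ F v → u ∈ₛ Graph.adj H v
    F⊆H {u} {v} u∈Fv = proj₁ (proj₁ sub u v u∈Fv)
    2≤deg : ∀ {v} → v ∈ₛ S → 2 ≤ ∣ F v ∣
    2≤deg {v} v∈S = ≰⇒> (λ deg≤1 → none (v , v∈S , deg≤1))

lemma4p3 : (n k : ℕ) → 1 ≤ n → 1 ≤ k → (e : Budget k) →
    n C 2 ≤ sum (tabulate e) →
    (c : Colouring n k) → Standard e c →
    ¬ RainbowCycle c × (∀ (p : ℕ) (H : Graph p) → DegeneracyTwo H → RainbowFree c H)
lemma4p3 n k _ _ e _ c std =
  no-rainbow-cycle std , λ p H (_ , not-1-degenerate) → rainbow-free std H not-1-degenerate
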